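{- Let $w$ be a permutation of length $\ell$, let $\rho,\pi$ be reduced words for $w$ with $\pi$ super-Yamanouchi, and for each $i$ let $\rho_{p_i}$ be the letter of $\rho$ to which $\pi_i$ is paired under the matching of $\rho$ to $\pi$. Then $\rho_{p_i} \le \pi_i$ for every $i$, and whenever $\pi_{i+1} < \pi_i$ we have $p_{i+1} > p_i$.
   Context: Words are written $\rho=(\rho_\ell,\ldots,\rho_1)$, indexed from right to left. A reduced word for $w$ is a word $(\rho_\ell,\ldots,\rho_1)$ with $s_{\rho_\ell}\cdots s_{\rho_1}=w$ where $w$ has exactly $\ell$ inversions. A word is super-Yamanouchi if it factors as a concatenation $(\pi^{(k)}\mid\cdots\mid\pi^{(1)})$ of increasing words, each consisting of consecutive integers, with $\min(\pi^{(j+1)})>\min(\pi^{(j)})$. Matching of $\rho$ to $\pi$: for $i$ from $\ell$ down to $1$, set $k=\pi_i$ and scan $j$ from $\ell$ down to $1$ as follows: if $\rho_j$ is already paired, decrement $j$; otherwise if $\rho_j = k$, pair $\rho_j$ with $\pi_i$ (and stop processing $\pi_i$); otherwise if $\rho_j = k-1$, decrement $k$ to $k-1$ and $j$ to $j-1$; otherwise decrement $j$. This procedure is well defined and pairs every letter of $\pi$ with a distinct letter of $\rho$. -}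

module Defs where

open import Data.Nat using (ℕ; zero; suc; _+_; _∸_; _≤_; _<_; _≡ᵇ_; _<ᵇ_)
open import Data.Bool using (Bool; true; false; if_then_else_)
open import Data.List using (List; []; _∷_; _++_; length; map; upTo; concatMap)
open import Data.Nat.ListAction using (sum)
open import Data.Bool.ListAction using (any)
open import Data.List.Relation.Unary.All using (All)
open import Data.Maybe using (Maybe; just; nothing)
open import Data.Product using (_×_; Σ; _,_)
open import Relation.Binary.PropositionalEquality using (_≡_)

-- A word (ρ_ℓ, …, ρ_1) is represented by the list [ρ_ℓ, …, ρ_1]
-- (written order; the head is ρ_ℓ).  Letters are positive integers.

-- Letter ρ_j (1 ≤ j ≤ ℓ) of a word: position ℓ - j in the list.
nth : List ℕ → ℕ → Maybe ℕ
nth []       _       = nothing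
nth (x ∷ xs) zero    = just x
nth (x ∷ xs) (suc k) = nth xs k

nthM : {A : Set} → List (Maybe A) → ℕ → Maybe A
nthM []       _       = nothing
nthM (x ∷ xs) zero    = x
nthM (x ∷ xs) (suc k) = nthM xs k

letter : List ℕ → ℕ → ℕ
letter w j with nth w (length w ∸ j)
... | just a  = a
... | nothing = 0

swap : ℕ → ℕ → ℕ
swap i x = if x ≡ᵇ i then suc i else (if x ≡ᵇ suc i then i else x)

prod : List ℕ → ℕ → ℕ
prod []       x = x
prod (a ∷ as) x = swap a (prod as x)

range : ℕ → ℕ → List ℕ
range lo hi = map (lo +_) (upTo (suc hi ∸ lo))

inv : ℕ → (ℕ → ℕ) → ℕ
inv n w = sum (map (λ a → sum (map (λ b → if w b <ᵇ w a then 1 else 0)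
                                    (range (suc a) n)))
                   (range 1 n))

ReducedWordFor : ℕ → (ℕ → ℕ) → List ℕ → Set
ReducedWordFor n w ρ =
  All (λ a → 1 ≤ a × a < n) ρ × (∀ x → prod ρ x ≡ w x) × length ρ ≡ inv n w

block : ℕ × ℕ → List ℕ
block (m , len) = map (m +_) (upTo len)

data DescBlocks : List (ℕ × ℕ) → Set where
  []  : DescBlocks []
  [_] : ∀ {m len} → 1 ≤ len → DescBlocks ((m , len) ∷ [])
  _∷_ : ∀ {m len m' len' bs} → 1 ≤ len → m' < m →
        DescBlocks ((m' , len') ∷ bs) → DescBlocks ((m , len) ∷ (m' , len') ∷ bs)

SuperYamanouchi : List ℕ → Set
SuperYamanouchi π = Σ (List (ℕ × ℕ)) λ bs → DescBlocks bs × π ≡ concatMap block bs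

member : ℕ → List ℕ → Bool
member j P = any (_≡ᵇ j) P

-- scan ρ P k j : the inner loop (j counts down from ℓ to 1; P = paired positions).
scan : List ℕ → List ℕ → ℕ → ℕ → Maybe ℕ
scan ρ P k zero = nothing
scan ρ P k (suc j) =
  if member (suc j) P then scan ρ P k j
  else (if letter ρ (suc j) ≡ᵇ k then just (suc j)
  else (if suc (letter ρ (suc j)) ≡ᵇ k then scan ρ P (k ∸ 1) j
  else scan ρ P k j))

-- Outer loop over π_ℓ, …, π_1 (the list of π in written order); results p_ℓ, …, p_1.
matchGo : List ℕ → List ℕ → List ℕ → List (Maybe ℕ)
matchGo ρ P []       = []
matchGo ρ P (k ∷ πs) with scan ρ P k (length ρ)
... | just j  = just j ∷ matchGo ρ (j ∷ P) πs
... | nothing = nothing ∷ matchGo ρ P πs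

pairedTo : List ℕ → List ℕ → ℕ → Maybe ℕ
pairedTo ρ π i = nthM (matchGo ρ [] π) (length π ∸ i)

-- The first claim holds for arbitrary words, since a scan only ever lowers the value it
-- looks for.  For the second, permutations are handled through their inverses prod⁻¹
-- (positions in one-line notation) and reducedness through its descent characterisation
-- Reduced, which follows from "length = inversion number" because every simple
-- transposition changes the inversion number by exactly one.  The heart is the exchange
-- lemma scan-pairs: if in the permutation of the unpaired letters of ρ the pair x < y is
-- Scannable, the scan for x succeeds, removing the letter found composes the permutation
-- with (x y), and a later scan for y continues strictly to the right of it.  Along the
-- matching the unpaired part of ρ stays a reduced word for the permutation of the
-- unprocessed part of π (Invariant); since π is super-Yamanouchi, the pair (k, k+1) is
-- Scannable at every step, and an ascent between neighbours of π is a step k < k+1.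
module Submission where

open import Defs
open import Data.Nat using (ℕ; zero; suc; _+_; _*_; _∸_; _≤_; _<_; _≡ᵇ_; _<ᵇ_; z≤n; s≤s; _≟_; _<?_)
open import Data.Nat.Properties
open import Data.Bool using (Bool; true; false; if_then_else_)
open import Data.Bool.Properties using (T-≡)
open import Function.Bundles using (Equivalence)
open import Data.List using (List; []; _∷_; _++_; length; map; upTo; applyUpTo; concatMap)
open import Data.List.Properties using (map-upTo; map-cong; ∷-injectiveˡ; ∷-injectiveʳ)
open import Data.Nat.Tactic.RingSolver using (solve-∀)
open import Data.Nat.ListAction using (sum)
open import Data.List.Relation.Unary.All as All using (All; []; _∷_; universal)
open import Data.Maybe using (just; nothing)
open import Data.Maybe.Properties using (just-injective)
open import Data.Product using (_×_; _,_; proj₁; proj₂)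
open import Data.Unit using (⊤; tt)
open import Data.Empty using (⊥; ⊥-elim)
open import Relation.Nullary using (¬_; yes; no)
open import Relation.Binary.Definitions using (tri<; tri≈; tri>)
open import Relation.Binary.PropositionalEquality

≡ᵇ-true : ∀ {m n} → m ≡ n → (m ≡ᵇ n) ≡ true
≡ᵇ-true {m} {n} m≡n = Equivalence.to T-≡ (≡⇒≡ᵇ m n m≡n)

≡ᵇ-false : ∀ {m n} → m ≢ n → (m ≡ᵇ n) ≡ false
≡ᵇ-false {zero}  {zero}  m≢n = ⊥-elim (m≢n refl)
≡ᵇ-false {zero}  {suc n} m≢n = refl
≡ᵇ-false {suc m} {zero}  m≢n = refl
≡ᵇ-false {suc m} {suc n} m≢n = ≡ᵇ-false {m} {n} (λ e → m≢n (cong suc e))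

≡ᵇ-true⁻¹ : ∀ {m n} → (m ≡ᵇ n) ≡ true → m ≡ n
≡ᵇ-true⁻¹ {m} {n} e = ≡ᵇ⇒≡ m n (Equivalence.from T-≡ e)

<ᵇ-true : ∀ {m n} → m < n → (m <ᵇ n) ≡ true
<ᵇ-true m<n = Equivalence.to T-≡ (<⇒<ᵇ m<n)

<ᵇ-false : ∀ {m n} → ¬ (m < n) → (m <ᵇ n) ≡ false
<ᵇ-false {m} {n} m≮n with m <ᵇ n in eq
... | false = refl
... | true  = ⊥-elim (m≮n (<ᵇ⇒< m n (Equivalence.from T-≡ eq)))

<ᵇ-cong : ∀ {m n p q} → (m < n → p < q) → (p < q → m < n) → (m <ᵇ n) ≡ (p <ᵇ q)
<ᵇ-cong {m} {n} to from with m <? n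
... | yes m<n = trans (<ᵇ-true m<n) (sym (<ᵇ-true (to m<n)))
... | no  m≮n = trans (<ᵇ-false m≮n) (sym (<ᵇ-false (λ p<q → m≮n (from p<q))))

-- Transpositions.  The simple transposition swap a of Defs is transpose a (suc a),
-- definitionally.

transpose : ℕ → ℕ → ℕ → ℕ
transpose x y z = if z ≡ᵇ x then y else (if z ≡ᵇ y then x else z)

transpose-left : ∀ x y z → z ≡ x → transpose x y z ≡ y
transpose-left x y z z≡x rewrite ≡ᵇ-true z≡x = refl

transpose-right : ∀ x y z → z ≢ x → z ≡ y → transpose x y z ≡ x
transpose-right x y z z≢x z≡y rewrite ≡ᵇ-false z≢x | ≡ᵇ-true z≡y = refl

transpose-other : ∀ x y z → z ≢ x → z ≢ y → transpose x y z ≡ z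
transpose-other x y z z≢x z≢y rewrite ≡ᵇ-false z≢x | ≡ᵇ-false z≢y = refl

transpose-involutive : ∀ x y z → transpose x y (transpose x y z) ≡ z
transpose-involutive x y z with z ≟ x
... | yes refl rewrite transpose-left z y z refl with y ≟ z
...   | yes refl = transpose-left y y y refl
...   | no  y≢z  = transpose-right z y y y≢z refl
transpose-involutive x y z | no z≢x with z ≟ y
...   | yes z≡y rewrite transpose-right x y z z≢x z≡y = trans (transpose-left x y x refl) (sym z≡y)
...   | no  z≢y rewrite transpose-other x y z z≢x z≢y = transpose-other x y z z≢x z≢y

transpose-conjugate : (σ : ℕ → ℕ) → (∀ {p q} → σ p ≡ σ q → p ≡ q) →
  ∀ u v z → transpose (σ u) (σ v) (σ z) ≡ σ (transpose u v z)
transpose-conjugate σ σ-inj u v z with z ≟ u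
... | yes z≡u rewrite transpose-left u v z z≡u = transpose-left (σ u) (σ v) (σ z) (cong σ z≡u)
... | no  z≢u with z ≟ v
...   | yes z≡v rewrite transpose-right u v z z≢u z≡v =
        transpose-right (σ u) (σ v) (σ z) (λ e → z≢u (σ-inj e)) (cong σ z≡v)
...   | no  z≢v rewrite transpose-other u v z z≢u z≢v =
        transpose-other (σ u) (σ v) (σ z) (λ e → z≢u (σ-inj e)) (λ e → z≢v (σ-inj e))

swap-self : ∀ a → swap a a ≡ suc a
swap-self a = transpose-left a (suc a) a refl

swap-suc : ∀ a → swap a (suc a) ≡ a
swap-suc a = transpose-right a (suc a) (suc a) (λ e → n≮n a (≤-reflexive e)) refl

swap-other : ∀ a z → z ≢ a → z ≢ suc a → swap a z ≡ z
swap-other a = transpose-other a (suc a)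

swap-involutive : ∀ a z → swap a (swap a z) ≡ z
swap-involutive a = transpose-involutive a (suc a)

swap-injective : ∀ a {p q} → swap a p ≡ swap a q → p ≡ q
swap-injective a {p} {q} e =
  trans (sym (swap-involutive a p)) (trans (cong (swap a) e) (swap-involutive a q))

prod⁻¹ : List ℕ → ℕ → ℕ
prod⁻¹ []       x = x
prod⁻¹ (a ∷ as) x = prod⁻¹ as (swap a x)

prod⁻¹-prod : ∀ xs x → prod⁻¹ xs (prod xs x) ≡ x
prod⁻¹-prod []       x = refl
prod⁻¹-prod (a ∷ as) x rewrite swap-involutive a (prod as x) = prod⁻¹-prod as x

prod-prod⁻¹ : ∀ xs x → prod xs (prod⁻¹ xs x) ≡ x
prod-prod⁻¹ []       x = refl
prod-prod⁻¹ (a ∷ as) x rewrite prod-prod⁻¹ as (swap a x) = swap-involutive a x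

prod⁻¹-++ : ∀ xs ys z → prod⁻¹ (xs ++ ys) z ≡ prod⁻¹ ys (prod⁻¹ xs z)
prod⁻¹-++ []       ys z = refl
prod⁻¹-++ (a ∷ xs) ys z = prod⁻¹-++ xs ys (swap a z)

prod⁻¹-injective : ∀ xs {p q} → prod⁻¹ xs p ≡ prod⁻¹ xs q → p ≡ q
prod⁻¹-injective xs {p} {q} e =
  trans (sym (prod-prod⁻¹ xs p)) (trans (cong (prod xs) e) (prod-prod⁻¹ xs q))

prod⁻¹-cong : ∀ ρ π → (∀ x → prod ρ x ≡ prod π x) → ∀ z → prod⁻¹ ρ z ≡ prod⁻¹ π z
prod⁻¹-cong ρ π same z =
  trans (sym (prod⁻¹-prod π (prod⁻¹ ρ z)))
        (cong (prod⁻¹ π) (trans (sym (same (prod⁻¹ ρ z))) (prod-prod⁻¹ ρ z)))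

-- The descent characterisation of reduced words: a ∷ as is reduced when as is reduced
-- and a is an ascent of (prod as)⁻¹, i.e. multiplying by s_a on the left adds an inversion.
Reduced : List ℕ → Set
Reduced []       = ⊤
Reduced (a ∷ as) = Reduced as × prod⁻¹ as a < prod⁻¹ as (suc a)

interval : ℕ → ℕ → List ℕ
interval lo zero    = []
interval lo (suc k) = lo ∷ interval (suc lo) k

applyUpTo-interval : ∀ k (f : ℕ → ℕ) lo → (∀ i → f i ≡ lo + i) → applyUpTo f k ≡ interval lo k
applyUpTo-interval zero    f lo f≗ = refl
applyUpTo-interval (suc k) f lo f≗ =
  cong₂ _∷_ (trans (f≗ 0) (+-identityʳ lo))
            (applyUpTo-interval k (λ i → f (suc i)) (suc lo) (λ i → trans (f≗ (suc i)) (+-suc lo i)))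

shifted-upTo : ∀ lo k → map (lo +_) (upTo k) ≡ interval lo k
shifted-upTo lo k = trans (map-upTo (lo +_) k) (applyUpTo-interval k (lo +_) lo (λ _ → refl))

interval-lower : ∀ lo k → All (lo ≤_) (interval lo k)
interval-lower lo zero    = []
interval-lower lo (suc k) =
  ≤-refl ∷ All.map (≤-trans (n≤1+n lo)) (interval-lower (suc lo) k)

occurrences : ℕ → List ℕ → ℕ
occurrences x []       = 0
occurrences x (y ∷ ys) = if y ≡ᵇ x then suc (occurrences x ys) else occurrences x ys

occurrences-below : ∀ x lo k → x < lo → occurrences x (interval lo k) ≡ 0
occurrences-below x lo zero    x<lo = refl
occurrences-below x lo (suc k) x<lo
  rewrite ≡ᵇ-false (>⇒≢ x<lo) = occurrences-below x (suc lo) k (m<n⇒m<1+n x<lo)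

occurrences-inside : ∀ x lo k → lo ≤ x → x < lo + k → occurrences x (interval lo k) ≡ 1
occurrences-inside x lo zero    lo≤x x<lo+0 = ⊥-elim (<⇒≱ x<lo+0 (subst (_≤ x) (sym (+-identityʳ lo)) lo≤x))
occurrences-inside x lo (suc k) lo≤x x<lo+k with lo ≟ x
... | yes refl rewrite ≡ᵇ-true {lo} refl = cong suc (occurrences-below lo (suc lo) k (n<1+n lo))
... | no  lo≢x rewrite ≡ᵇ-false lo≢x =
  occurrences-inside x (suc lo) k (≤∧≢⇒< lo≤x lo≢x) (subst (x <_) (+-suc lo k) x<lo+k)

occurrences-range : ∀ x lo hi → lo ≤ x → x ≤ hi → occurrences x (range lo hi) ≡ 1
occurrences-range x lo hi lo≤x x≤hi rewrite shifted-upTo lo (suc hi ∸ lo) =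
  occurrences-inside x lo (suc hi ∸ lo) lo≤x
    (subst (x <_) (sym (m+[n∸m]≡n (≤-trans lo≤x (m≤n⇒m≤1+n x≤hi)))) (s≤s x≤hi))

occurrences-range-below : ∀ x lo hi → x < lo → occurrences x (range lo hi) ≡ 0
occurrences-range-below x lo hi x<lo rewrite shifted-upTo lo (suc hi ∸ lo) =
  occurrences-below x lo (suc hi ∸ lo) x<lo

sum-exchange : (f g : ℕ → ℕ) (x0 : ℕ) → (∀ x → x ≢ x0 → f x ≡ g x) → ∀ xs →
  sum (map g xs) + f x0 * occurrences x0 xs ≡ sum (map f xs) + g x0 * occurrences x0 xs
sum-exchange f g x0 agree [] = trans (*-zeroʳ (f x0)) (sym (*-zeroʳ (g x0)))
sum-exchange f g x0 agree (x ∷ xs) with x ≟ x0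
... | yes refl rewrite ≡ᵇ-true {x} refl =
  trans (regroup₁ (g x) (f x) (sum (map g xs)) (occurrences x xs))
    (trans (cong (g x + f x +_) (sum-exchange f g x agree xs))
           (regroup₂ (g x) (f x) (sum (map f xs)) (occurrences x xs)))
  where
  regroup₁ : ∀ g f sg c → g + sg + f * suc c ≡ g + f + (sg + f * c)
  regroup₁ = solve-∀
  regroup₂ : ∀ g f sf c → g + f + (sf + g * c) ≡ f + sf + g * suc c
  regroup₂ = solve-∀
... | no x≢x0 rewrite ≡ᵇ-false x≢x0 | agree x x≢x0 =
  trans (+-assoc (g x) _ _) (trans (cong (g x +_) (sum-exchange f g x0 agree xs)) (sym (+-assoc (g x) _ _)))

sum-exchange-once : (f g : ℕ → ℕ) (x0 : ℕ) → (∀ x → x ≢ x0 → f x ≡ g x) → ∀ xs →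
  occurrences x0 xs ≡ 1 → sum (map g xs) + f x0 ≡ sum (map f xs) + g x0
sum-exchange-once f g x0 agree xs once
  with sum-exchange f g x0 agree xs
... | e rewrite once | *-identityʳ (f x0) | *-identityʳ (g x0) = e

sum-agree : (f g : ℕ → ℕ) (x0 : ℕ) → (∀ x → x ≢ x0 → f x ≡ g x) → ∀ xs →
  occurrences x0 xs ≡ 0 → sum (map f xs) ≡ sum (map g xs)
sum-agree f g x0 agree xs absent
  with sum-exchange f g x0 agree xs
... | e rewrite absent | *-zeroʳ (f x0) | *-zeroʳ (g x0) | +-identityʳ (sum (map g xs))
              | +-identityʳ (sum (map f xs)) = sym e

pairSum : ℕ → (ℕ → ℕ → ℕ) → ℕ
pairSum n h = sum (map (λ a → sum (map (h a) (range (suc a) n))) (range 1 n))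

pairSum-exchange : ∀ n (f g : ℕ → ℕ → ℕ) a0 b0 → 1 ≤ a0 → a0 < b0 → b0 ≤ n →
  (∀ a b → ¬ (a ≡ a0 × b ≡ b0) → ¬ (a ≡ b0 × b ≡ a0) → f a b ≡ g a b) →
  pairSum n g + f a0 b0 ≡ pairSum n f + g a0 b0
pairSum-exchange n f g a0 b0 1≤a0 a0<b0 b0≤n agree =
  combine (pairSum n g) (pairSum n f) (F a0) (G a0) (f a0 b0) (g a0 b0) outer inner
  where
  F G : ℕ → ℕ
  F a = sum (map (f a) (range (suc a) n))
  G a = sum (map (g a) (range (suc a) n))
  rows-agree : ∀ a → a ≢ a0 → F a ≡ G a
  rows-agree a a≢a0 with a ≟ b0
  ... | yes refl = sum-agree (f a) (g a) a0 (λ b b≢a0 → agree a b (λ p → a≢a0 (proj₁ p)) (λ p → b≢a0 (proj₂ p)))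
                     (range (suc a) n) (occurrences-range-below a0 (suc a) n (m<n⇒m<1+n a0<b0))
  ... | no a≢b0 = cong sum (map-cong (λ b → agree a b (λ p → a≢a0 (proj₁ p)) (λ p → a≢b0 (proj₁ p))) (range (suc a) n))
  outer : pairSum n g + F a0 ≡ pairSum n f + G a0
  outer = sum-exchange-once F G a0 rows-agree (range 1 n) (occurrences-range a0 1 n 1≤a0 (≤-trans (<⇒≤ a0<b0) b0≤n))
  inner : G a0 + f a0 b0 ≡ F a0 + g a0 b0
  inner = sum-exchange-once (f a0) (g a0) b0
            (λ b b≢b0 → agree a0 b (λ p → b≢b0 (proj₂ p)) (λ p → <⇒≢ a0<b0 (proj₁ p)))
            (range (suc a0) n) (occurrences-range b0 (suc a0) n a0<b0 b0≤n)
  combine : ∀ sg sf F0 G0 f0 g0 → sg + F0 ≡ sf + G0 → G0 + f0 ≡ F0 + g0 → sg + f0 ≡ sf + g0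
  combine sg sf F0 G0 f0 g0 e₁ e₂ = +-cancelʳ-≡ (F0 + G0) (sg + f0) (sf + g0)
    (trans (regroupˡ sg F0 G0 f0) (trans (cong₂ _+_ e₁ e₂) (regroupʳ sf G0 F0 g0)))
    where
    regroupˡ : ∀ sg F0 G0 f0 → sg + f0 + (F0 + G0) ≡ sg + F0 + (G0 + f0)
    regroupˡ = solve-∀
    regroupʳ : ∀ sf G0 F0 g0 → sf + G0 + (F0 + g0) ≡ sf + g0 + (F0 + G0)
    regroupʳ = solve-∀

swap-monotone : ∀ c {β α} → ¬ (β ≡ c × α ≡ suc c) → β < α → swap c β < swap c α
swap-monotone c {β} {α} not-pair β<α with β ≟ c
... | yes refl rewrite swap-self β =
  let α≢sβ = λ e → not-pair (refl , e) in
  subst (suc β <_) (sym (swap-other β α (>⇒≢ β<α) α≢sβ)) (≤∧≢⇒< β<α (λ e → α≢sβ (sym e)))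
... | no β≢c with β ≟ suc c
...   | yes refl rewrite swap-suc c =
  subst (c <_) (sym (swap-other c α (>⇒≢ (<-trans (n<1+n c) β<α)) (>⇒≢ β<α))) (<-trans (n<1+n c) β<α)
...   | no β≢sc rewrite swap-other c β β≢c β≢sc with α ≟ c
...     | yes refl rewrite swap-self α = <-trans β<α (n<1+n α)
...     | no α≢c with α ≟ suc c
...       | yes refl rewrite swap-suc c = ≤∧≢⇒< (m<1+n⇒m≤n β<α) β≢c
...       | no α≢sc rewrite swap-other c α α≢c α≢sc = β<α

swap-reflects : ∀ c {β α} → ¬ (β ≡ suc c × α ≡ c) → swap c β < swap c α → β < α
swap-reflects c {β} {α} not-pair lt =
  subst₂ _<_ (swap-involutive c β) (swap-involutive c α) (swap-monotone c not-pair′ lt)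
  where
  not-pair′ : ¬ (swap c β ≡ c × swap c α ≡ suc c)
  not-pair′ (e₁ , e₂) = not-pair ( swap-injective c (trans e₁ (sym (swap-suc c)))
                                 , swap-injective c (trans e₂ (sym (swap-self c))))

indicator : Bool → ℕ
indicator b = if b then 1 else 0

inv-swap : ∀ n (v τ : ℕ → ℕ) → (∀ x → v (τ x) ≡ x) → (∀ x → τ (v x) ≡ x) → ∀ c →
  1 ≤ τ c → τ c ≤ n → 1 ≤ τ (suc c) → τ (suc c) ≤ n →
  (τ c < τ (suc c) → inv n (λ x → swap c (v x)) ≡ suc (inv n v)) ×
  (τ (suc c) < τ c → suc (inv n (λ x → swap c (v x))) ≡ inv n v)
inv-swap n v τ vτ τv c 1≤τc τc≤n 1≤τsc τsc≤n = up , down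
  where
  before after : ℕ → ℕ → ℕ
  before a b = indicator (v b <ᵇ v a)
  after  a b = indicator (swap c (v b) <ᵇ swap c (v a))
  pulled : ∀ {a b x y} → v a ≡ x × v b ≡ y → a ≡ τ x × b ≡ τ y
  pulled (refl , refl) = sym (τv _) , sym (τv _)
  agree : ∀ a b → ¬ (a ≡ τ c × b ≡ τ (suc c)) → ¬ (a ≡ τ (suc c) × b ≡ τ c) → before a b ≡ after a b
  agree a b n₁ n₂ = cong indicator (<ᵇ-cong
    (swap-monotone c (λ (e₁ , e₂) → n₂ (pulled (e₂ , e₁))))
    (swap-reflects c (λ (e₁ , e₂) → n₁ (pulled (e₂ , e₁)))))
  c<sc : c < suc c
  c<sc = n<1+n c
  up : τ c < τ (suc c) → inv n (λ x → swap c (v x)) ≡ suc (inv n v)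
  up lt with pairSum-exchange n before after (τ c) (τ (suc c)) 1≤τc lt τsc≤n agree
  ... | e rewrite vτ c | vτ (suc c) | swap-self c | swap-suc c
                | <ᵇ-false (<-asym c<sc) | <ᵇ-true c<sc | +-identityʳ (pairSum n after) = trans e (+-comm _ 1)
  down : τ (suc c) < τ c → suc (inv n (λ x → swap c (v x))) ≡ inv n v
  down lt with pairSum-exchange n before after (τ (suc c)) (τ c) 1≤τsc lt τc≤n (λ a b n₁ n₂ → agree a b n₂ n₁)
  ... | e rewrite vτ c | vτ (suc c) | swap-self c | swap-suc c
                | <ᵇ-false (<-asym c<sc) | <ᵇ-true c<sc | +-identityʳ (pairSum n before) = trans (+-comm 1 _) e

range-lower : ∀ lo hi → All (lo ≤_) (range lo hi)
range-lower lo hi rewrite shifted-upTo lo (suc hi ∸ lo) = interval-lower lo (suc hi ∸ lo)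

sum-zero : ∀ (h : ℕ → ℕ) xs → All (λ x → h x ≡ 0) xs → sum (map h xs) ≡ 0
sum-zero h []       []          = refl
sum-zero h (x ∷ xs) (hx≡0 ∷ hs) rewrite hx≡0 = sum-zero h xs hs

inv-identity : ∀ n → inv n (λ x → x) ≡ 0
inv-identity n = sum-zero _ (range 1 n) (universal row-zero (range 1 n))
  where
  row-zero : ∀ a → sum (map (λ b → indicator (b <ᵇ a)) (range (suc a) n)) ≡ 0
  row-zero a = sum-zero _ (range (suc a) n)
    (All.map (λ a<b → cong indicator (<ᵇ-false (<-asym a<b))) (range-lower (suc a) n))

Letters : ℕ → List ℕ → Set
Letters n = All (λ a → 1 ≤ a × a < n)

swap-in-range : ∀ n a z → 1 ≤ a → a < n → 1 ≤ z → z ≤ n → 1 ≤ swap a z × swap a z ≤ n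
swap-in-range n a z 1≤a a<n 1≤z z≤bound with z ≟ a
... | yes refl rewrite swap-self z = s≤s z≤n , a<n
... | no  z≢a with z ≟ suc a
...   | yes refl rewrite swap-suc a = 1≤a , ≤-trans (n≤1+n a) z≤bound
...   | no  z≢sa rewrite swap-other a z z≢a z≢sa = 1≤z , z≤bound

prod⁻¹-in-range : ∀ n xs → Letters n xs → ∀ z → 1 ≤ z → z ≤ n → 1 ≤ prod⁻¹ xs z × prod⁻¹ xs z ≤ n
prod⁻¹-in-range n []       []                 z 1≤z z≤bound = 1≤z , z≤bound
prod⁻¹-in-range n (a ∷ as) ((1≤a , a<n) ∷ ls) z 1≤z z≤bound =
  let (1≤z′ , z′≤bound) = swap-in-range n a z 1≤a a<n 1≤z z≤bound in prod⁻¹-in-range n as ls (swap a z) 1≤z′ z′≤bound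

module _ (n : ℕ) where

  inv-prod-cons : ∀ c as → 1 ≤ c → c < n → Letters n as →
    (prod⁻¹ as c < prod⁻¹ as (suc c) → inv n (prod (c ∷ as)) ≡ suc (inv n (prod as))) ×
    (prod⁻¹ as (suc c) < prod⁻¹ as c → suc (inv n (prod (c ∷ as))) ≡ inv n (prod as))
  inv-prod-cons c as 1≤c c<n ls =
    inv-swap n (prod as) (prod⁻¹ as) (prod-prod⁻¹ as) (prod⁻¹-prod as) c
      (proj₁ range-c) (proj₂ range-c) (proj₁ range-sc) (proj₂ range-sc)
    where
    range-c  = prod⁻¹-in-range n as ls c 1≤c (<⇒≤ c<n)
    range-sc = prod⁻¹-in-range n as ls (suc c) (s≤s z≤n) c<n

  inv-≤-length : ∀ xs → Letters n xs → inv n (prod xs) ≤ length xs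
  inv-≤-length []       []                 = ≤-reflexive (inv-identity n)
  inv-≤-length (c ∷ as) ((1≤c , c<n) ∷ ls) with <-cmp (prod⁻¹ as c) (prod⁻¹ as (suc c))
  ... | tri< asc _ _ = subst (_≤ suc (length as)) (sym (proj₁ (inv-prod-cons c as 1≤c c<n ls) asc))
                             (s≤s (inv-≤-length as ls))
  ... | tri≈ _ e _   = ⊥-elim (<⇒≢ (n<1+n c) (prod⁻¹-injective as e))
  ... | tri> _ _ des = m≤n⇒m≤1+n (≤-trans (n≤1+n _) (subst (_≤ length as)
                         (sym (proj₂ (inv-prod-cons c as 1≤c c<n ls) des)) (inv-≤-length as ls)))

  reduced-if-length-inv : ∀ xs → Letters n xs → length xs ≡ inv n (prod xs) → Reduced xs
  reduced-if-length-inv []       []                 _ = tt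
  reduced-if-length-inv (c ∷ as) ((1≤c , c<n) ∷ ls) e with <-cmp (prod⁻¹ as c) (prod⁻¹ as (suc c))
  ... | tri< asc _ _ =
    reduced-if-length-inv as ls (suc-injective (trans e (proj₁ (inv-prod-cons c as 1≤c c<n ls) asc))) , asc
  ... | tri≈ _ e′ _ = ⊥-elim (<⇒≢ (n<1+n c) (prod⁻¹-injective as e′))
  ... | tri> _ _ des = ⊥-elim (<-irrefl refl (begin-strict
        suc (length as)                ≡⟨ e ⟩
        inv n (prod (c ∷ as))          <⟨ n<1+n _ ⟩
        suc (inv n (prod (c ∷ as)))    ≡⟨ proj₂ (inv-prod-cons c as 1≤c c<n ls) des ⟩
        inv n (prod as)                ≤⟨ inv-≤-length as ls ⟩
        length as                      <⟨ n<1+n _ ⟩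
        suc (length as)                ∎))
    where open ≤-Reasoning

reduced-of-ReducedWordFor : ∀ n w ρ → ReducedWordFor n w ρ → Reduced ρ
reduced-of-ReducedWordFor n w ρ (letters , product , length≡inv) =
  reduced-if-length-inv n ρ letters (trans length≡inv (inv-cong (λ x → sym (product x))))
  where
  inv-cong : ∀ {f g} → (∀ x → f x ≡ g x) → inv n f ≡ inv n g
  inv-cong f≗g = cong sum (map-cong (λ a → cong sum (map-cong
    (λ b → cong₂ (λ u v → indicator (u <ᵇ v)) (f≗g b) (f≗g a)) (range (suc a) n))) (range 1 n))

IncreasingAbove : ℕ → (ℕ → ℕ) → Set
IncreasingAbove m f = ∀ y z → m < y → y < z → f y < f z

-- prod⁻¹ of the interval word m, m+1, …, m+L-1 is the cycle m ↦ m+L ↦ m+L-1 ↦ ⋯ ↦ m+1 ↦ m: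
-- it fixes everything below m and is increasing above m, with values at least m there.
interval-fixes-below : ∀ m L z → z < m → prod⁻¹ (interval m L) z ≡ z
interval-fixes-below m zero    z z<m = refl
interval-fixes-below m (suc L) z z<m rewrite swap-other m z (<⇒≢ z<m) (<⇒≢ (m<n⇒m<1+n z<m)) =
  interval-fixes-below (suc m) L z (m<n⇒m<1+n z<m)

interval-above : ∀ m L y → m < y → m ≤ prod⁻¹ (interval m L) y
interval-above m zero    y m<y = <⇒≤ m<y
interval-above m (suc L) y m<y with y ≟ suc m
... | yes refl rewrite swap-suc m | interval-fixes-below (suc m) L m (n<1+n m) = ≤-refl
... | no  y≢sm rewrite swap-other m y (>⇒≢ m<y) y≢sm =
  ≤-trans (n≤1+n m) (interval-above (suc m) L y (≤∧≢⇒< m<y (λ e → y≢sm (sym e))))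

interval-increasing : ∀ m L → IncreasingAbove m (prod⁻¹ (interval m L))
interval-increasing m zero    y z _   y<z = y<z
interval-increasing m (suc L) y z m<y y<z
  rewrite swap-other m z (>⇒≢ (<-trans m<y y<z)) (>⇒≢ (≤-<-trans m<y y<z)) with y ≟ suc m
... | yes refl rewrite swap-suc m | interval-fixes-below (suc m) L m (n<1+n m) = interval-above (suc m) L z y<z
... | no  y≢sm rewrite swap-other m y (>⇒≢ m<y) y≢sm =
  interval-increasing (suc m) L y z (≤∧≢⇒< m<y (λ e → y≢sm (sym e))) y<z

block-interval : ∀ m L → block (m , L) ≡ interval m L
block-interval m L = shifted-upTo m L

block-cons : ∀ m L → block (m , suc L) ≡ m ∷ block (suc m , L)
block-cons m L = trans (block-interval m (suc L)) (cong (m ∷_) (sym (block-interval (suc m) L)))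

DescBlocks-tail : ∀ {b bs} → DescBlocks (b ∷ bs) → DescBlocks bs
DescBlocks-tail [ _ ]       = []
DescBlocks-tail (_∷_ _ _ d) = d

-- The concatenation of the blocks is increasing above the minimum of the first block, as
-- every later block lives strictly below it.
blocks-increasing : ∀ m L bs → DescBlocks ((m , L) ∷ bs) → IncreasingAbove m (prod⁻¹ (concatMap block ((m , L) ∷ bs)))
blocks-increasing m L bs d y z m<y y<z
  rewrite prod⁻¹-++ (block (m , L)) (concatMap block bs) y | prod⁻¹-++ (block (m , L)) (concatMap block bs) z
        | block-interval m L = later bs d
  where
  later : ∀ bs → DescBlocks ((m , L) ∷ bs) →
    prod⁻¹ (concatMap block bs) (prod⁻¹ (interval m L) y) < prod⁻¹ (concatMap block bs) (prod⁻¹ (interval m L) z)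
  later []                  _           = interval-increasing m L y z m<y y<z
  later ((m′ , L′) ∷ bs′) (_∷_ _ m′<m d) =
    blocks-increasing m′ L′ bs′ d _ _ (<-≤-trans m′<m (interval-above m L y m<y)) (interval-increasing m L y z m<y y<z)

record FirstBlock (k : ℕ) (πs : List ℕ) : Set where
  field
    len   : ℕ
    rest  : List (ℕ × ℕ)
    desc  : DescBlocks ((k , suc len) ∷ rest)
    shape : k ∷ πs ≡ concatMap block ((k , suc len) ∷ rest)

first-block : ∀ k πs → SuperYamanouchi (k ∷ πs) → FirstBlock k πs
first-block k πs ([] , _ , ())
first-block k πs (((m , zero) ∷ rest) , [ () ] , eq)
first-block k πs (((m , zero) ∷ rest) , _∷_ () _ _ , eq)
first-block k πs (((m , suc len) ∷ rest) , d , eq)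
  with ∷-injectiveˡ (trans eq (cong (_++ concatMap block rest) (block-cons m len)))
... | refl = record { len = len ; rest = rest ; desc = d ; shape = eq }

SY-increasing : ∀ k πs → SuperYamanouchi (k ∷ πs) → IncreasingAbove k (prod⁻¹ (k ∷ πs))
SY-increasing k πs sy with first-block k πs sy
... | record { len = len ; rest = rest ; desc = d ; shape = shape } =
  subst (λ w → IncreasingAbove k (prod⁻¹ w)) (sym shape) (blocks-increasing k (suc len) rest d)

SY-tail : ∀ k πs → SuperYamanouchi (k ∷ πs) → SuperYamanouchi πs
SY-tail k πs sy with first-block k πs sy
... | record { len = zero ; rest = rest ; desc = d ; shape = shape } =
  rest , DescBlocks-tail d , ∷-injectiveʳ (trans shape (cong (_++ concatMap block rest) (block-cons k 0)))
... | record { len = suc l ; rest = rest ; desc = d ; shape = shape } =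
  ((suc k , suc l) ∷ rest) , shifted d ,
  ∷-injectiveʳ (trans shape (cong (_++ concatMap block rest) (block-cons k (suc l))))
  where
  shifted : DescBlocks ((k , suc (suc l)) ∷ rest) → DescBlocks ((suc k , suc l) ∷ rest)
  shifted [ _ ]            = [ s≤s z≤n ]
  shifted (_∷_ _ m′<k d′) = _∷_ (s≤s z≤n) (m<n⇒m<1+n m′<k) d′

-- Inside a super-Yamanouchi word an ascent k < k′ between neighbours is a step k′ = k+1
-- within a block: a new block starts lower.
SY-ascent : ∀ k k′ πs → SuperYamanouchi (k ∷ k′ ∷ πs) → k < k′ → k′ ≡ suc k
SY-ascent k k′ πs sy k<k′ with first-block k (k′ ∷ πs) sy
... | record { len = suc l ; rest = rest ; shape = shape } =
  ∷-injectiveˡ (∷-injectiveʳ (trans shape (cong (_++ concatMap block rest)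
    (trans (block-cons k (suc l)) (cong (k ∷_) (block-cons (suc k) l))))))
... | record { len = zero ; rest = rest ; desc = d ; shape = shape } =
  ⊥-elim (next-block-lower rest d (∷-injectiveʳ (trans shape (cong (_++ concatMap block rest) (block-cons k 0)))))
  where
  next-block-lower : ∀ rest → DescBlocks ((k , 1) ∷ rest) → k′ ∷ πs ≡ [] ++ concatMap block rest → ⊥
  next-block-lower []                        _              ()
  next-block-lower ((m′ , zero)  ∷ rest′) (_∷_ _ _ [ () ])
  next-block-lower ((m′ , zero)  ∷ rest′) (_∷_ _ _ (_∷_ () _ _))
  next-block-lower ((m′ , suc L) ∷ rest′) (_∷_ _ m′<k _) e
    with ∷-injectiveˡ (trans e (cong (_++ concatMap block rest′) (block-cons m′ L)))
  ... | refl = <-asym m′<k k<k′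

-- Whenever z is a position of the word γ, prod⁻¹ γ z is where z stands in the one-line
-- notation of prod γ.  The scan for x (with target y = x+1 at the start) keeps this shape:
-- y stands left of x, the values strictly between them right of x, those above y right of y.
record Scannable (γ : List ℕ) (x y : ℕ) : Set where
  constructor scannable
  field
    reduced         : Reduced γ
    y-before-x      : prod⁻¹ γ y < prod⁻¹ γ x
    between-after-x : ∀ z → x < z → z < y → prod⁻¹ γ x < prod⁻¹ γ z
    above-after-y   : ∀ z → y < z → prod⁻¹ γ y < prod⁻¹ γ z

via-swap : ∀ γ a p q {p′ q′} → swap a p ≡ p′ → swap a q ≡ q′ →
  prod⁻¹ (a ∷ γ) p < prod⁻¹ (a ∷ γ) q → prod⁻¹ γ p′ < prod⁻¹ γ q′
via-swap γ a p q refl refl lt = lt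

-- The first letter a of a scannable word a ∷ γ cannot be the target y: s_a would undo an
-- ascent of γ.
not-target : ∀ γ a x y → Scannable (a ∷ γ) x y → a ≢ y
not-target γ a x y (scannable (_ , asc) _ _ above) refl =
  <-asym asc (via-swap γ a a (suc a) (swap-self a) (swap-suc a) (above (suc a) (n<1+n a)))

crossing-target : ∀ γ a y → a < y → Scannable (a ∷ γ) a y → y ≡ suc a
crossing-target γ a y a<y (scannable (_ , asc) _ between _) with y ≟ suc a
... | yes y≡sa = y≡sa
... | no  y≢sa = ⊥-elim (<-asym asc (via-swap γ a a (suc a) (swap-self a) (swap-suc a)
                   (between (suc a) (n<1+n a) (≤∧≢⇒< a<y (λ e → y≢sa (sym e))))))

-- Passing a letter a ≠ x of a ∷ γ: the scan continues on γ with the pair conjugated by s_a,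
-- which is again scannable, and a remains an ascent after the eventual transposition.
record Passing (γ : List ℕ) (a x y : ℕ) : Set where
  field
    ordered   : swap a x < swap a y
    continues : Scannable γ (swap a x) (swap a y)
    ascent    : prod⁻¹ γ (transpose (swap a x) (swap a y) a) < prod⁻¹ γ (transpose (swap a x) (swap a y) (suc a))

passing-via : ∀ {γ a x y x′ y′} → swap a x ≡ x′ → swap a y ≡ y′ → x′ < y′ → Scannable γ x′ y′ →
  prod⁻¹ γ (transpose x′ y′ a) < prod⁻¹ γ (transpose x′ y′ (suc a)) → Passing γ a x y
passing-via refl refl x′<y′ s asc = record { ordered = x′<y′ ; continues = s ; ascent = asc }

a≢sa : ∀ a → a ≢ suc a
a≢sa a = <⇒≢ (n<1+n a)

-- The letter a = x-1 lowers the scanned value: the scan continues for a.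
passing-lower : ∀ γ a y → suc a < y → Scannable (a ∷ γ) (suc a) y → Passing γ a (suc a) y
passing-lower γ a y sa<y (scannable (red , asc) y<x between above) =
  passing-via (swap-suc a) fixed-y a<y (scannable red y<a between′ above′)
    (subst₂ (λ p q → prod⁻¹ γ p < prod⁻¹ γ q) (sym (transpose-left a y a refl))
            (sym (transpose-other a y (suc a) (≢-sym (a≢sa a)) (<⇒≢ sa<y))) (<-trans y<a asc))
  where
  a<y = <-trans (n<1+n a) sa<y
  fixed-y : swap a y ≡ y
  fixed-y = swap-other a y (>⇒≢ a<y) (>⇒≢ sa<y)
  y<a : prod⁻¹ γ y < prod⁻¹ γ a
  y<a = via-swap γ a y (suc a) fixed-y (swap-suc a) y<x
  between′ : ∀ z → a < z → z < y → prod⁻¹ γ a < prod⁻¹ γ z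
  between′ z a<z z<y with z ≟ suc a
  ... | yes refl = asc
  ... | no  z≢sa = via-swap γ a (suc a) z (swap-suc a) (swap-other a z (>⇒≢ a<z) z≢sa)
                     (between z (≤∧≢⇒< a<z (λ e → z≢sa (sym e))) z<y)
  above′ : ∀ z → y < z → prod⁻¹ γ y < prod⁻¹ γ z
  above′ z y<z = via-swap γ a y z fixed-y (swap-other a z (>⇒≢ (<-trans a<y y<z)) (>⇒≢ (<-trans sa<y y<z)))
                   (above z y<z)

-- The letter a = y-1 lowers the target: the scan continues with target a.
passing-lower-target : ∀ γ a x → x < a → Scannable (a ∷ γ) x (suc a) → Passing γ a x (suc a)
passing-lower-target γ a x x<a (scannable (red , asc) y<x between above) =
  passing-via fixed-x (swap-suc a) x<a (scannable red a<x between′ above′)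
    (subst₂ (λ p q → prod⁻¹ γ p < prod⁻¹ γ q) (sym (transpose-right x a a (>⇒≢ x<a) refl))
            (sym (transpose-other x a (suc a) (>⇒≢ (m<n⇒m<1+n x<a)) (≢-sym (a≢sa a))))
            (via-swap γ a x a fixed-x (swap-self a) (between a x<a (n<1+n a))))
  where
  fixed-x : swap a x ≡ x
  fixed-x = swap-other a x (<⇒≢ x<a) (<⇒≢ (m<n⇒m<1+n x<a))
  a<x : prod⁻¹ γ a < prod⁻¹ γ x
  a<x = via-swap γ a (suc a) x (swap-suc a) fixed-x y<x
  between′ : ∀ z → x < z → z < a → prod⁻¹ γ x < prod⁻¹ γ z
  between′ z x<z z<a = via-swap γ a x z fixed-x (swap-other a z (<⇒≢ z<a) (<⇒≢ (m<n⇒m<1+n z<a)))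
                         (between z x<z (m<n⇒m<1+n z<a))
  above′ : ∀ z → a < z → prod⁻¹ γ a < prod⁻¹ γ z
  above′ z a<z with z ≟ suc a
  ... | yes refl = asc
  ... | no  z≢sa = via-swap γ a (suc a) z (swap-suc a) (swap-other a z (>⇒≢ a<z) z≢sa)
                     (above z (≤∧≢⇒< a<z (λ e → z≢sa (sym e))))

passing-disjoint : ∀ γ a x y → x < y → a ≢ x → suc a ≢ x → a ≢ y → suc a ≢ y →
  Scannable (a ∷ γ) x y → Passing γ a x y
passing-disjoint γ a x y x<y a≢x sa≢x a≢y sa≢y (scannable (red , asc) y<x between above) =
  passing-via fixed-x fixed-y x<y (scannable red (via-swap γ a y x fixed-y fixed-x y<x) between′ above′)
    (subst₂ (λ p q → prod⁻¹ γ p < prod⁻¹ γ q) (sym (transpose-other x y a a≢x a≢y))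
            (sym (transpose-other x y (suc a) sa≢x sa≢y)) asc)
  where
  fixed-x : swap a x ≡ x
  fixed-x = swap-other a x (≢-sym a≢x) (≢-sym sa≢x)
  fixed-y : swap a y ≡ y
  fixed-y = swap-other a y (≢-sym a≢y) (≢-sym sa≢y)
  between′ : ∀ z → x < z → z < y → prod⁻¹ γ x < prod⁻¹ γ z
  between′ z x<z z<y with z ≟ a | z ≟ suc a
  ... | yes refl | _ = via-swap γ z x (suc z) fixed-x (swap-suc z)
                         (between (suc z) (m<n⇒m<1+n x<z) (≤∧≢⇒< z<y sa≢y))
  ... | no z≢a | yes refl = via-swap γ a x a fixed-x (swap-self a)
                              (between a (≤∧≢⇒< (m<1+n⇒m≤n x<z) (≢-sym a≢x)) (<-trans (n<1+n a) z<y))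
  ... | no z≢a | no z≢sa = via-swap γ a x z fixed-x (swap-other a z z≢a z≢sa) (between z x<z z<y)
  above′ : ∀ z → y < z → prod⁻¹ γ y < prod⁻¹ γ z
  above′ z y<z with z ≟ a | z ≟ suc a
  ... | yes refl | _ = via-swap γ z y (suc z) fixed-y (swap-suc z) (above (suc z) (m<n⇒m<1+n y<z))
  ... | no z≢a | yes refl = via-swap γ a y a fixed-y (swap-self a)
                              (above a (≤∧≢⇒< (m<1+n⇒m≤n y<z) (≢-sym a≢y)))
  ... | no z≢a | no z≢sa = via-swap γ a y z fixed-y (swap-other a z z≢a z≢sa) (above z y<z)

passing : ∀ γ a x y → x < y → a ≢ x → Scannable (a ∷ γ) x y → Passing γ a x y
passing γ a x y x<y a≢x s with suc a ≟ x | suc a ≟ y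
... | yes refl | _ = passing-lower γ a y x<y s
... | no sa≢x | yes refl = passing-lower-target γ a x (≤∧≢⇒< (m<1+n⇒m≤n x<y) (≢-sym a≢x)) s
... | no sa≢x | no sa≢y = passing-disjoint γ a x y x<y a≢x sa≢x (not-target γ a x y s) sa≢y s

unpaired : List ℕ → List ℕ → ℕ → List ℕ
unpaired ρ P zero    = []
unpaired ρ P (suc j) = if member (suc j) P then unpaired ρ P j else letter ρ (suc j) ∷ unpaired ρ P j

member-other : ∀ q P i → q ≢ i → member i (q ∷ P) ≡ member i P
member-other q P i q≢i rewrite ≡ᵇ-false q≢i = refl

member-self : ∀ P i → member i (i ∷ P) ≡ true
member-self P i rewrite ≡ᵇ-true {i} refl = refl

member-keep : ∀ q P i → member i P ≡ true → member i (q ∷ P) ≡ true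
member-keep q P i i∈P rewrite i∈P with q ≡ᵇ i
... | true  = refl
... | false = refl

unpaired-above : ∀ ρ P q j → j < q → unpaired ρ (q ∷ P) j ≡ unpaired ρ P j
unpaired-above ρ P q zero    j<q = refl
unpaired-above ρ P q (suc j) j<q
  rewrite member-other q P (suc j) (>⇒≢ j<q) | unpaired-above ρ P q j (<-trans (n<1+n j) j<q) = refl

module _ (ρ Q : List ℕ) (j : ℕ) where

  scan-paired : ∀ k → member (suc j) Q ≡ true → scan ρ Q k (suc j) ≡ scan ρ Q k j
  scan-paired k paired rewrite paired = refl

  scan-hit : ∀ k → member (suc j) Q ≡ false → letter ρ (suc j) ≡ k → scan ρ Q k (suc j) ≡ just (suc j)
  scan-hit k free hit rewrite free | ≡ᵇ-true hit = refl

  scan-pass : ∀ a k → member (suc j) Q ≡ false → letter ρ (suc j) ≡ a → a ≢ k →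
    scan ρ Q k (suc j) ≡ scan ρ Q (swap a k) j
  scan-pass a k free hit a≢k rewrite free | hit | ≡ᵇ-false a≢k with suc a ≟ k
  ... | yes refl rewrite swap-suc a | ≡ᵇ-true {suc a} refl = refl
  ... | no sa≢k  rewrite ≡ᵇ-false sa≢k | swap-other a k (≢-sym a≢k) (≢-sym sa≢k) = refl

  unpaired-paired : member (suc j) Q ≡ true → unpaired ρ Q (suc j) ≡ unpaired ρ Q j
  unpaired-paired paired rewrite paired = refl

  unpaired-free : ∀ a → member (suc j) Q ≡ false → letter ρ (suc j) ≡ a →
    unpaired ρ Q (suc j) ≡ a ∷ unpaired ρ Q j
  unpaired-free a free hit rewrite free | hit = refl

-- The outcome of a scan for x from position j, with target y: it pairs ρ_{q+1} (q < j);
-- the remaining word stays reduced and its inverse product gets composed with (x y); and a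
-- later scan for y passes position q+1, continuing below it for some value v.
record Pairing (ρ P : List ℕ) (x y j : ℕ) : Set where
  constructor pairing
  field
    q       : ℕ
    found   : scan ρ P x j ≡ just (suc q)
    below   : suc q ≤ j
    v       : ℕ
    resume  : scan ρ (suc q ∷ P) y j ≡ scan ρ (suc q ∷ P) v q
    reduced : Reduced (unpaired ρ (suc q ∷ P) j)
    product : ∀ z → prod⁻¹ (unpaired ρ (suc q ∷ P) j) z ≡ prod⁻¹ (unpaired ρ P j) (transpose x y z)

pairing-skip : ∀ ρ P j x y → member (suc j) P ≡ true → Pairing ρ P x y j → Pairing ρ P x y (suc j)
pairing-skip ρ P j x y paired (pairing q found below v resume red prod≡) =
  pairing q (trans (scan-paired ρ P j x paired) found) (m≤n⇒m≤1+n below) v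
    (trans (scan-paired ρ (suc q ∷ P) j y paired′) resume)
    (subst Reduced (sym unpaired≡) red)
    (λ z → trans (cong (λ γ → prod⁻¹ γ z) unpaired≡)
                 (trans (prod≡ z) (cong (λ γ → prod⁻¹ γ (transpose x y z)) (sym (unpaired-paired ρ P j paired)))))
  where
  paired′ = member-keep (suc q) P (suc j) paired
  unpaired≡ = unpaired-paired ρ (suc q ∷ P) j paired′

pairing-hit : ∀ ρ P j a → member (suc j) P ≡ false → letter ρ (suc j) ≡ a →
  Reduced (unpaired ρ P j) → Pairing ρ P a (suc a) (suc j)
pairing-hit ρ P j a free hit red =
  pairing j (scan-hit ρ P j a free hit) ≤-refl (suc a) (scan-paired ρ (suc j ∷ P) j (suc a) (member-self P (suc j)))
    (subst Reduced (sym unpaired≡) red)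
    (λ z → begin
      prod⁻¹ (unpaired ρ (suc j ∷ P) (suc j)) z   ≡⟨ cong (λ γ → prod⁻¹ γ z) unpaired≡ ⟩
      prod⁻¹ (unpaired ρ P j) z                   ≡⟨ cong (prod⁻¹ (unpaired ρ P j)) (sym (swap-involutive a z)) ⟩
      prod⁻¹ (a ∷ unpaired ρ P j) (swap a z)      ≡⟨ cong (λ γ → prod⁻¹ γ (swap a z)) (sym (unpaired-free ρ P j a free hit)) ⟩
      prod⁻¹ (unpaired ρ P (suc j)) (swap a z)    ∎)
  where
  open ≡-Reasoning
  unpaired≡ : unpaired ρ (suc j ∷ P) (suc j) ≡ unpaired ρ P j
  unpaired≡ = trans (unpaired-paired ρ (suc j ∷ P) j (member-self P (suc j))) (unpaired-above ρ P (suc j) j ≤-refl)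

pairing-pass : ∀ ρ P j a x y → member (suc j) P ≡ false → letter ρ (suc j) ≡ a → a ≢ x → a ≢ y →
  (let τ = prod⁻¹ (unpaired ρ P j) ; t = transpose (swap a x) (swap a y) in τ (t a) < τ (t (suc a))) →
  Pairing ρ P (swap a x) (swap a y) j → Pairing ρ P x y (suc j)
pairing-pass ρ P j a x y free hit a≢x a≢y asc (pairing q found below v resume red prod≡) =
  pairing q (trans (scan-pass ρ P j a x free hit a≢x) found) (m≤n⇒m≤1+n below) v
    (trans (scan-pass ρ (suc q ∷ P) j a y free′ hit a≢y) resume)
    (subst Reduced (sym unpaired≡) (red , subst₂ _<_ (sym (prod≡ a)) (sym (prod≡ (suc a))) asc))
    (λ z → begin
      prod⁻¹ (unpaired ρ (suc q ∷ P) (suc j)) z              ≡⟨ cong (λ γ → prod⁻¹ γ z) unpaired≡ ⟩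
      prod⁻¹ (unpaired ρ (suc q ∷ P) j) (swap a z)          ≡⟨ prod≡ (swap a z) ⟩
      τ (transpose (swap a x) (swap a y) (swap a z))          ≡⟨ cong τ (transpose-conjugate (swap a) (swap-injective a) x y z) ⟩
      τ (swap a (transpose x y z))                            ≡⟨ cong (λ γ → prod⁻¹ γ (transpose x y z)) (sym (unpaired-free ρ P j a free hit)) ⟩
      prod⁻¹ (unpaired ρ P (suc j)) (transpose x y z)         ∎)
  where
  open ≡-Reasoning
  τ = prod⁻¹ (unpaired ρ P j)
  free′ = trans (member-other (suc q) P (suc j) (<⇒≢ (s≤s below))) free
  unpaired≡ = unpaired-free ρ (suc q ∷ P) j a free′ hit

scan-pairs : ∀ ρ P j x y → x < y → Scannable (unpaired ρ P j) x y → Pairing ρ P x y j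
scan-pairs ρ P zero    x y x<y s = ⊥-elim (<-asym x<y (Scannable.y-before-x s))
scan-pairs ρ P (suc j) x y x<y s with member (suc j) P in status
... | true  = pairing-skip ρ P j x y status (scan-pairs ρ P j x y x<y s)
... | false = at-letter (letter ρ (suc j)) refl
  where
  at-letter : ∀ a → letter ρ (suc j) ≡ a → Pairing ρ P x y (suc j)
  at-letter a hit with subst (λ b → Scannable (b ∷ unpaired ρ P j) x y) hit s | a ≟ x
  ... | s′ | yes refl rewrite crossing-target (unpaired ρ P j) a y x<y s′ =
    pairing-hit ρ P j a status hit (proj₁ (Scannable.reduced s′))
  ... | s′ | no a≢x =
    pairing-pass ρ P j a x y status hit a≢x (not-target (unpaired ρ P j) a x y s′) (Passing.ascent p)
      (scan-pairs ρ P j (swap a x) (swap a y) (Passing.ordered p) (Passing.continues p))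
    where p = passing (unpaired ρ P j) a x y x<y a≢x s′

scan-bound : ∀ ρ P k j p → scan ρ P k j ≡ just p → p ≤ j
scan-bound ρ P k zero    p ()
scan-bound ρ P k (suc j) p found with member (suc j) P
... | true = m≤n⇒m≤1+n (scan-bound ρ P k j p found)
... | false with letter ρ (suc j) ≡ᵇ k
...   | true = ≤-reflexive (sym (just-injective found))
...   | false with suc (letter ρ (suc j)) ≡ᵇ k
...     | true  = m≤n⇒m≤1+n (scan-bound ρ P (k ∸ 1) j p found)
...     | false = m≤n⇒m≤1+n (scan-bound ρ P k j p found)

-- The scanned value only decreases, so the letter found is at most the one searched for.
scan-letter-≤ : ∀ ρ P k j p → scan ρ P k j ≡ just p → letter ρ p ≤ k
scan-letter-≤ ρ P k zero    p ()
scan-letter-≤ ρ P k (suc j) p found with member (suc j) P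
... | true = scan-letter-≤ ρ P k j p found
... | false with letter ρ (suc j) ≡ᵇ k in hit
...   | true rewrite sym (just-injective found) = ≤-reflexive (≡ᵇ-true⁻¹ hit)
...   | false with suc (letter ρ (suc j)) ≡ᵇ k
...     | true  = ≤-trans (scan-letter-≤ ρ P (k ∸ 1) j p found) (m∸n≤m k 1)
...     | false = scan-letter-≤ ρ P k j p found

matchGo-found : ∀ ρ P k πs j → scan ρ P k (length ρ) ≡ just j → matchGo ρ P (k ∷ πs) ≡ just j ∷ matchGo ρ (j ∷ P) πs
matchGo-found ρ P k πs j found rewrite found = refl

matchGo-head : ∀ ρ P k πs p → nthM (matchGo ρ P (k ∷ πs)) 0 ≡ just p → scan ρ P k (length ρ) ≡ just p
matchGo-head ρ P k πs p e with scan ρ P k (length ρ)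
... | just j  = e
... | nothing = e

paired-letter-≤ : ∀ ρ P πs t p a → nthM (matchGo ρ P πs) t ≡ just p → nth πs t ≡ just a → letter ρ p ≤ a
paired-letter-≤ ρ P []       t p a _ ()
paired-letter-≤ ρ P (k ∷ πs) t p a paired at with scan ρ P k (length ρ) in found
paired-letter-≤ ρ P (k ∷ πs) zero    p a paired at | just j
  rewrite sym (just-injective paired) | sym (just-injective at) = scan-letter-≤ ρ P k (length ρ) j found
paired-letter-≤ ρ P (k ∷ πs) (suc t) p a paired at | just j  = paired-letter-≤ ρ (j ∷ P) πs t p a paired at
paired-letter-≤ ρ P (k ∷ πs) zero    p a ()     at | nothing
paired-letter-≤ ρ P (k ∷ πs) (suc t) p a paired at | nothing = paired-letter-≤ ρ P πs t p a paired at

-- The invariant of the matching, with P the positions paired so far and πs the letters of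
-- π still to be processed: the unpaired letters of ρ form a reduced word for the same
-- permutation as πs, and πs is a reduced super-Yamanouchi word.
record Invariant (ρ P πs : List ℕ) : Set where
  constructor invariant
  field
    remainder-reduced : Reduced (unpaired ρ P (length ρ))
    same-inverse      : ∀ z → prod⁻¹ (unpaired ρ P (length ρ)) z ≡ prod⁻¹ πs z
    pending-reduced   : Reduced πs
    pending-SY        : SuperYamanouchi πs

-- Processing one letter k of π: the scan pairs some ρ_{q+1}, the invariant is kept, and a
-- following letter k+1 is paired strictly to the right of ρ_{q+1}.
record Step (ρ P : List ℕ) (k : ℕ) (πs : List ℕ) : Set where
  field
    q         : ℕ
    found     : scan ρ P k (length ρ) ≡ just (suc q)
    continues : Invariant ρ (suc q ∷ P) πs
    next-left : ∀ p → scan ρ (suc q ∷ P) (suc k) (length ρ) ≡ just p → p < suc q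

step : ∀ ρ P k πs → Invariant ρ P (k ∷ πs) → Step ρ P k πs
step ρ P k πs (invariant red same (red-πs , ascent) sy) = outcome (scan-pairs ρ P (length ρ) k (suc k) (n<1+n k) start)
  where
  γ = unpaired ρ P (length ρ)
  start : Scannable γ k (suc k)
  start = scannable red
    (subst₂ _<_ (sym (trans (same (suc k)) (cong (prod⁻¹ πs) (swap-suc k))))
                (sym (trans (same k) (cong (prod⁻¹ πs) (swap-self k)))) ascent)
    (λ z k<z z<sk → ⊥-elim (<⇒≱ k<z (m<1+n⇒m≤n z<sk)))
    (λ z sk<z → subst₂ _<_ (sym (same (suc k))) (sym (same z)) (SY-increasing k πs sy (suc k) z (n<1+n k) sk<z))
  outcome : Pairing ρ P k (suc k) (length ρ) → Step ρ P k πs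
  outcome (pairing q found _ v resume red′ product) = record
    { q         = q
    ; found     = found
    ; continues = invariant red′ (λ z → trans (product z) (trans (same (swap k z)) (cong (prod⁻¹ πs) (swap-involutive k z))))
                    red-πs (SY-tail k πs sy)
    ; next-left = λ p e → s≤s (scan-bound ρ (suc q ∷ P) v q p (trans (sym resume) e))
    }

ascent-paired-left : ∀ ρ P πs → Invariant ρ P πs → ∀ t a b p q → nth πs t ≡ just a → nth πs (suc t) ≡ just b →
  a < b → nthM (matchGo ρ P πs) t ≡ just q → nthM (matchGo ρ P πs) (suc t) ≡ just p → p < q
ascent-paired-left ρ P []       _   t a b p q () _ _ _ _
ascent-paired-left ρ P (k ∷ πs) inv t a b p q at-t at-st a<b paired-t paired-st
  with step ρ P k πs inv
... | record { q = q₀ ; found = found ; continues = inv′ ; next-left = next-left }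
  rewrite matchGo-found ρ P k πs (suc q₀) found with t | πs
... | zero  | []      = ⊥-elim (nothing≢just at-st)
  where nothing≢just : ∀ {x : ℕ} → nothing ≢ just x
        nothing≢just ()
... | zero  | b′ ∷ πs′ rewrite sym (just-injective at-t) | sym (just-injective at-st) | sym (just-injective paired-t)
                              | SY-ascent k b′ πs′ (Invariant.pending-SY inv) a<b =
  next-left p (matchGo-head ρ (suc q₀ ∷ P) (suc k) πs′ p paired-st)
... | suc t′ | πs′ = ascent-paired-left ρ (suc q₀ ∷ P) πs′ inv′ t′ a b p q at-t at-st a<b paired-t paired-st

letter-cons : ∀ x xs j → j ≤ length xs → letter (x ∷ xs) j ≡ letter xs j
letter-cons x xs j j≤ℓ rewrite +-∸-assoc 1 j≤ℓ = refl

letter-top : ∀ x xs → letter (x ∷ xs) (suc (length xs)) ≡ x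
letter-top x xs rewrite n∸n≡0 (length xs) = refl

unpaired-cons : ∀ x xs j → j ≤ length xs → unpaired (x ∷ xs) [] j ≡ unpaired xs [] j
unpaired-cons x xs zero    _   = refl
unpaired-cons x xs (suc j) j<ℓ = cong₂ _∷_ (letter-cons x xs (suc j) j<ℓ) (unpaired-cons x xs j (<⇒≤ j<ℓ))

unpaired-all : ∀ ρ → unpaired ρ [] (length ρ) ≡ ρ
unpaired-all []       = refl
unpaired-all (x ∷ xs) = cong₂ _∷_ (letter-top x xs) (trans (unpaired-cons x xs (length xs) ≤-refl) (unpaired-all xs))

nth-defined : ∀ (xs : List ℕ) t → t < length xs → nth xs t ≢ nothing
nth-defined (x ∷ xs) zero    _         ()
nth-defined (x ∷ xs) (suc t) (s≤s t<ℓ) = nth-defined xs t t<ℓ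

letter-nth : ∀ xs i → 1 ≤ i → i ≤ length xs → nth xs (length xs ∸ i) ≡ just (letter xs i)
letter-nth xs i 1≤i i≤ℓ with nth xs (length xs ∸ i) | nth-defined xs (length xs ∸ i) (∸-monoʳ-< 1≤i i≤ℓ)
... | just a  | _       = refl
... | nothing | defined = ⊥-elim (defined refl)

initial-invariant : ∀ n w ρ π → ReducedWordFor n w ρ → ReducedWordFor n w π → SuperYamanouchi π → Invariant ρ [] π
initial-invariant n w ρ π word-ρ word-π sy =
  invariant (subst Reduced (sym (unpaired-all ρ)) (reduced-of-ReducedWordFor n w ρ word-ρ))
    (λ z → trans (cong (λ γ → prod⁻¹ γ z) (unpaired-all ρ))
                 (prod⁻¹-cong ρ π (λ x → trans (proj₁ (proj₂ word-ρ) x) (sym (proj₁ (proj₂ word-π) x))) z))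
    (reduced-of-ReducedWordFor n w π word-π) sy

lemma13 : (n : ℕ) (w : ℕ → ℕ) (ρ π : List ℕ) →
    ReducedWordFor n w ρ → ReducedWordFor n w π → SuperYamanouchi π →
    ((i p : ℕ) → 1 ≤ i → i ≤ length π → pairedTo ρ π i ≡ just p →
      letter ρ p ≤ letter π i)
    ×
    ((i p q : ℕ) → 1 ≤ i → suc i ≤ length π → letter π (suc i) < letter π i →
      pairedTo ρ π i ≡ just p → pairedTo ρ π (suc i) ≡ just q → p < q)
lemma13 n w ρ π word-ρ word-π sy = letters-≤ , ascents-left
  where
  ℓ = length π
  letters-≤ : (i p : ℕ) → 1 ≤ i → i ≤ ℓ → pairedTo ρ π i ≡ just p → letter ρ p ≤ letter π i
  letters-≤ i p 1≤i i≤ℓ paired = paired-letter-≤ ρ [] π (ℓ ∸ i) p (letter π i) paired (letter-nth π i 1≤i i≤ℓ)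
  ascents-left : (i p q : ℕ) → 1 ≤ i → suc i ≤ ℓ → letter π (suc i) < letter π i →
    pairedTo ρ π i ≡ just p → pairedTo ρ π (suc i) ≡ just q → p < q
  ascents-left i p q 1≤i si≤ℓ ascent paired-i paired-si =
    ascent-paired-left ρ [] π (initial-invariant n w ρ π word-ρ word-π sy) (ℓ ∸ suc i) _ _ p q
      (letter-nth π (suc i) (s≤s z≤n) si≤ℓ)
      (subst (λ t → nth π t ≡ just (letter π i)) shift (letter-nth π i 1≤i (<⇒≤ si≤ℓ)))
      ascent paired-si
      (subst (λ t → nthM (matchGo ρ [] π) t ≡ just p) shift paired-i)
    where
    -- ℓ - i = (ℓ - (i+1)) + 1: π_i immediately follows π_{i+1} in the list.
    shift : ℓ ∸ i ≡ suc (ℓ ∸ suc i)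
    shift = +-∸-assoc 1 si≤ℓ
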